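{- There exists a planar hypohamiltonian graph on exactly $40$ vertices that has a nontrivial automorphism.
   Context: All graphs are finite and simple. A graph $G$ is hypohamiltonian if $G$ has no Hamiltonian cycle, but for every vertex $v$ of $G$ the graph $G - v$ has a Hamiltonian cycle. A nontrivial automorphism is a graph automorphism other than the identity. -}

module Defs where

open import Data.Nat using (ℕ; zero; suc; _≤_)
open import Data.Fin using (Fin; zero; suc; toℕ; fromℕ; punchIn)
open import Data.Bool using (Bool; true; false)
open import Data.Product using (Σ; _×_; _,_; ∃; ∃-syntax)
open import Data.Sum using (_⊎_)
open import Data.Empty using (⊥)
open import Relation.Nullary using (¬_)
open import Relation.Binary.PropositionalEquality using (_≡_; _≢_)
open import Function.Definitions using (Injective; Surjective)
open import Data.Rational using (ℚ; 0ℚ; 1ℚ; _+_; _*_; _-_) renaming (_≤_ to _≤ℚ_)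

record Graph (n : ℕ) : Set where
  field
    adj   : Fin n → Fin n → Bool
    sym   : ∀ i j → adj i j ≡ adj j i
    loopless : ∀ i → adj i i ≡ false
open Graph public

Adjacent : ∀ {n} → Graph n → Fin n → Fin n → Set
Adjacent G i j = adj G i j ≡ true

-- The vertex-deleted subgraph G - v (vertices of G - v are Fin n,
-- identified with the vertices of G other than v via punchIn v).
_-v_ : ∀ {n} → Graph (suc n) → Fin (suc n) → Graph n
G -v v = record
  { adj = λ i j → adj G (punchIn v i) (punchIn v j)
  ; sym = λ i j → sym G (punchIn v i) (punchIn v j)
  ; loopless = λ i → loopless G (punchIn v i)
  }

record HamCycle {k : ℕ} (G : Graph (suc k)) : Set where
  field
    atLeast3 : 3 ≤ suc k
    order    : Fin (suc k) → Fin (suc k)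
    injective  : Injective _≡_ _≡_ order
    surjective : Surjective _≡_ _≡_ order
    consecutive : ∀ i j → toℕ j ≡ suc (toℕ i) → Adjacent G (order i) (order j)
    closing : Adjacent G (order (fromℕ k)) (order zero)

Hamiltonian : ∀ {m} → Graph m → Set
Hamiltonian {zero} G = ⊥
Hamiltonian {suc k} G = HamCycle G

Hypohamiltonian : ∀ {n} → Graph (suc n) → Set
Hypohamiltonian G = ¬ Hamiltonian G × (∀ v → Hamiltonian (G -v v))

record Automorphism {n : ℕ} (G : Graph n) : Set where
  field
    π : Fin n → Fin n
    injective  : Injective _≡_ _≡_ π
    surjective : Surjective _≡_ _≡_ π
    preserves  : ∀ i j → adj G (π i) (π j) ≡ adj G i j

NontrivialAutomorphism : ∀ {n} → Graph n → Set
NontrivialAutomorphism G = Σ (Automorphism G) λ σ → ∃[ i ] Automorphism.π σ i ≢ i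

Point : Set
Point = ℚ × ℚ

OnSegment : Point → Point → Point → Set
OnSegment (x₁ , x₂) (p₁ , p₂) (q₁ , q₂) =
  ∃[ t ] (0ℚ ≤ℚ t × t ≤ℚ 1ℚ × x₁ ≡ p₁ + t * (q₁ - p₁) × x₂ ≡ p₂ + t * (q₂ - p₂))

record StraightLineEmbedding {n : ℕ} (G : Graph n) : Set where
  field
    pos : Fin n → Point
    pos-injective : Injective _≡_ _≡_ pos
    no-vertex-on-edge : ∀ a b v → Adjacent G a b → v ≢ a → v ≢ b →
                        ¬ OnSegment (pos v) (pos a) (pos b)
    edges-meet-at-endpoints : ∀ a b c d → Adjacent G a b → Adjacent G c d →
      ¬ ((a ≡ c × b ≡ d) ⊎ (a ≡ d × b ≡ c)) →
      ∀ x → OnSegment x (pos a) (pos b) → OnSegment x (pos c) (pos d) →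
      ∃[ v ] (x ≡ pos v × (v ≡ a ⊎ v ≡ b) × (v ≡ c ⊎ v ≡ d))

-- Planar: G admits a plane straight-line drawing (Fáry's theorem).
Planar : ∀ {n} → Graph n → Set
Planar G = StraightLineEmbedding G

{-# OPTIONS --safe #-}
-- The graph is given by adjacency lists, and each property is certified by a finite
-- computation. Planarity: a straight-line drawing with integer coordinates in which no
-- vertex lies on the line through an edge it does not belong to, and for any two disjoint
-- edges both endpoints of one lie strictly on the same side of the line through the other.
-- Every vertex-deleted subgraph comes with a Hamiltonian cycle, and the automorphism is an
-- explicit involution. The graph itself is shown non-Hamiltonian by a backtracking search
-- for a cycle through a fixed vertex s, which abandons a path as soon as some unvisited
-- vertex has fewer than two neighbours left that could be its neighbours on the cycle. The
-- search is sound: along a Hamiltonian cycle rotated to start at s, every unvisited vertex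
-- keeps both of its cycle neighbours available, so the search would follow that cycle.
module Submission where

open import Defs
open import Data.Bool using (Bool; true; false; _∧_; _∨_; not; T)
import Data.Bool.Properties as Bool
open import Data.Bool.Properties using (T-∧; T-∨; T-≡)
open import Data.Empty using (⊥; ⊥-elim)
open import Data.Fin using (Fin; zero; suc; toℕ; fromℕ; fromℕ<; inject₁; punchOut)
open import Data.Fin.Properties
  using (toℕ-injective; toℕ<n; toℕ-fromℕ; toℕ-fromℕ<; toℕ-inject₁; all?; any?; pigeonhole;
         punchOut-injective; <⇒≢)
  renaming (_≟_ to _≟ᶠ_)
open import Data.List using (List; []; _∷_; head; drop)
open import Data.List.Membership.Propositional using (_∈_; _∉_)
open import Data.List.Relation.Unary.All as All using (All)
open import Data.List.Relation.Unary.Any using (here; there)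
open import Data.Maybe using (fromMaybe)
open import Data.Nat using (ℕ; zero; suc; _≡ᵇ_; z≤n; s≤s; s≤s⁻¹; z<s)
import Data.Nat as ℕ
open import Data.Nat.Properties using (≡ᵇ⇒≡; ≡⇒≡ᵇ; suc-injective; n<1+n)
open import Data.Product using (Σ; _×_; _,_; ∃; proj₁; proj₂)
open import Data.Rational using (0ℚ)
open import Data.Sum using (_⊎_; inj₁; inj₂; [_,_]′)
open import Data.Vec using (Vec; lookup)
open import Function using (_∘_; Injective; Surjective)
open import Function.Bundles using (Equivalence)
open import Relation.Nullary using (Dec; yes; no; ¬_; contradiction)
open import Relation.Nullary.Decidable using (T?; _×-dec_; _⊎-dec_; _→-dec_; from-yes)
import Relation.Binary.PropositionalEquality as ≡
open ≡ using (_≡_; _≢_; refl; cong; cong₂; subst; subst₂; trans; module ≡-Reasoning)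

infix 4 _∈ᵇ_

-- Direct recursion rather than `any`: the search below is run by the type checker, and
-- this halves its running time.
_∈ᵇ_ : ℕ → List ℕ → Bool
x ∈ᵇ []     = false
x ∈ᵇ y ∷ ys = (x ≡ᵇ y) ∨ (x ∈ᵇ ys)

∈ᵇ⇒∈ : ∀ {x} xs → T (x ∈ᵇ xs) → x ∈ xs
∈ᵇ⇒∈ {x} (y ∷ ys) = [ here ∘ ≡ᵇ⇒≡ x y , there ∘ ∈ᵇ⇒∈ ys ]′ ∘ Equivalence.to T-∨

∈⇒∈ᵇ : ∀ {x xs} → x ∈ xs → T (x ∈ᵇ xs)
∈⇒∈ᵇ {x} (here refl)  = Equivalence.from T-∨ (inj₁ (≡⇒≡ᵇ x x refl))
∈⇒∈ᵇ     (there x∈xs) = Equivalence.from T-∨ (inj₂ (∈⇒∈ᵇ x∈xs))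

∉⇒∉ᵇ : ∀ {x} xs → x ∉ xs → T (not (x ∈ᵇ xs))
∉⇒∉ᵇ {x} xs x∉xs with x ∈ᵇ xs | ∈ᵇ⇒∈ {x} xs
... | false | _    = _
... | true  | sound = x∉xs (sound _)

Onto : ∀ {n} → (Fin n → Fin n) → Set
Onto f = ∀ y → ∃ λ i → f i ≡ y

onto? : ∀ {n} (f : Fin n → Fin n) → Dec (Onto f)
onto? f = all? λ y → any? λ i → f i ≟ᶠ y

injective⇒onto : ∀ {n} {f : Fin n → Fin n} → (∀ i j → f i ≡ f j → i ≡ j) → Onto f
injective⇒onto {suc m} {f} inj y with any? (λ i → f i ≟ᶠ y)
... | yes hit  = hit
... | no  miss =
  let i , j , i<j , collide = pigeonhole (n<1+n m) (punchOut ∘ y≢f)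
  in  contradiction (inj i j (punchOut-injective (y≢f i) (y≢f j) collide)) (<⇒≢ i<j)
  where
    y≢f : ∀ i → y ≢ f i
    y≢f i y≡fi = miss (i , ≡.sym y≡fi)

-- Choosing a preimage of each point gives an injective section, which is onto by the
-- pigeonhole principle; f inverts it, so f is injective.
onto⇒injective : ∀ {n} {f : Fin n → Fin n} → Onto f → Injective _≡_ _≡_ f
onto⇒injective {n} {f} onto {i} {j} fi≡fj =
  let a , sa≡i = section-onto i
      b , sb≡j = section-onto j
      a≡b = begin
        a             ≡⟨ proj₂ (onto a) ⟨
        f (section a) ≡⟨ cong f sa≡i ⟩
        f i           ≡⟨ fi≡fj ⟩
        f j           ≡⟨ cong f sb≡j ⟨
        f (section b) ≡⟨ proj₂ (onto b) ⟩
        b             ∎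
  in  trans (≡.sym sa≡i) (trans (cong section a≡b) sb≡j)
  where
    open ≡-Reasoning
    section : Fin n → Fin n
    section y = proj₁ (onto y)
    section-onto : Onto section
    section-onto = injective⇒onto λ a b eq →
      trans (≡.sym (proj₂ (onto a))) (trans (cong f eq) (proj₂ (onto b)))

onto⇒surjective : ∀ {n} {f : Fin n → Fin n} → Onto f → Surjective _≡_ _≡_ f
onto⇒surjective onto y = proj₁ (onto y) , λ { refl → proj₂ (onto y) }

adjacency : ∀ {n} → (ℕ → List ℕ) → Fin n → Fin n → Bool
adjacency nb i j = toℕ j ∈ᵇ nb (toℕ i)

adjacent? : ∀ {n} (G : Graph n) i j → Dec (Adjacent G i j)
adjacent? G i j = adj G i j Bool.≟ true

adjacent-sym : ∀ {n} (G : Graph n) {i j} → Adjacent G i j → Adjacent G j i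
adjacent-sym G {i} {j} ij = trans (sym G j i) ij

adjacent⇒≢ : ∀ {n} (G : Graph n) {i j} → Adjacent G i j → i ≢ j
adjacent⇒≢ G {i} ii refl with trans (≡.sym ii) (loopless G i)
... | ()

module _ {k : ℕ} (G : Graph (suc k)) where

  IsHamiltonianOrder : (Fin (suc k) → Fin (suc k)) → Set
  IsHamiltonianOrder f = Onto f
                       × (∀ (i : Fin k) → Adjacent G (f (inject₁ i)) (f (suc i)))
                       × Adjacent G (f (fromℕ k)) (f zero)

  isHamiltonianOrder? : ∀ f → Dec (IsHamiltonianOrder f)
  isHamiltonianOrder? f = onto? f
                   ×-dec all? (λ i → adjacent? G (f (inject₁ i)) (f (suc i)))
                   ×-dec adjacent? G (f (fromℕ k)) (f zero)

  hamCycle : ∀ {f} → 3 ℕ.≤ suc k → IsHamiltonianOrder f → HamCycle G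
  hamCycle {f} 3≤n (onto , steps , closes) = record
    { atLeast3    = 3≤n
    ; order       = f
    ; injective   = onto⇒injective onto
    ; surjective  = onto⇒surjective onto
    ; consecutive = consecutive
    ; closing     = closes
    }
    where
      consecutive : ∀ i j → toℕ j ≡ suc (toℕ i) → Adjacent G (f i) (f j)
      consecutive i (suc j) 1+j≡1+i = subst (λ i → Adjacent G (f i) (f (suc j)))
        (toℕ-injective (trans (toℕ-inject₁ j) (suc-injective 1+j≡1+i))) (steps j)

IsAutomorphism : ∀ {n} → Graph n → (Fin n → Fin n) → Set
IsAutomorphism G f = Onto f × (∀ i j → adj G (f i) (f j) ≡ adj G i j)

isAutomorphism? : ∀ {n} (G : Graph n) f → Dec (IsAutomorphism G f)
isAutomorphism? G f = onto? f ×-dec all? λ i → all? λ j → adj G (f i) (f j) Bool.≟ adj G i j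

automorphism : ∀ {n} {G : Graph n} {f} → IsAutomorphism G f → Automorphism G
automorphism {f = f} (onto , preserves) = record
  { π          = f
  ; injective  = onto⇒injective onto
  ; surjective = onto⇒surjective onto
  ; preserves  = preserves
  }

-- Cyclic shifts modulo n

module _ (n : ℕ) .{{_ : ℕ.NonZero n}} where
  open import Data.Nat using (_+_; _*_; _∸_; _≤_; _<_)
  open import Data.Nat.DivMod
    using (_%_; _/_; m%n<n; m≡m%n+[m/n]*n; [m+kn]%n≡m%n; [m+n]%n≡m%n; %-distribˡ-+; m%n%n≡m%n;
           m<n⇒m%n≡m)
  open import Data.Nat.Properties using (+-comm; +-assoc; m+[n∸m]≡n)
  open ≡-Reasoning

  suc-% : ∀ m → suc m % n ≡ suc (m % n) % n
  suc-% m = begin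
    suc m % n                     ≡⟨ cong (λ x → suc x % n) (m≡m%n+[m/n]*n m n) ⟩
    (suc (m % n) + m / n * n) % n ≡⟨ [m+kn]%n≡m%n (suc (m % n)) (m / n) n ⟩
    suc (m % n) % n               ∎

  %-+-congʳ : ∀ {x y} c → x % n ≡ y % n → (x + c) % n ≡ (y + c) % n
  %-+-congʳ {x} {y} c eq = begin
    (x + c) % n         ≡⟨ %-distribˡ-+ x c n ⟩
    (x % n + c % n) % n ≡⟨ cong (λ z → (z + c % n) % n) eq ⟩
    (y % n + c % n) % n ≡⟨ %-distribˡ-+ y c n ⟨
    (y + c) % n         ∎

  %-+-congˡ : ∀ c {x y} → x % n ≡ y % n → (c + x) % n ≡ (c + y) % n
  %-+-congˡ c {x} {y} eq = begin
    (c + x) % n ≡⟨ cong (_% n) (+-comm c x) ⟩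
    (x + c) % n ≡⟨ %-+-congʳ c eq ⟩
    (y + c) % n ≡⟨ cong (_% n) (+-comm y c) ⟩
    (c + y) % n ∎

  module _ {i} (i≤n : i ≤ n) where

    private
      unshift : ∀ x → i + x + (n ∸ i) ≡ x + n
      unshift x = begin
        i + x + (n ∸ i)   ≡⟨ cong (_+ (n ∸ i)) (+-comm i x) ⟩
        x + i + (n ∸ i)   ≡⟨ +-assoc x i (n ∸ i) ⟩
        x + (i + (n ∸ i)) ≡⟨ cong (x +_) (m+[n∸m]≡n i≤n) ⟩
        x + n             ∎

    +-%-injective : ∀ {a b} → a < n → b < n → (i + a) % n ≡ (i + b) % n → a ≡ b
    +-%-injective {a} {b} a<n b<n eq = begin
      a                     ≡⟨ m<n⇒m%n≡m a<n ⟨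
      a % n                 ≡⟨ [m+n]%n≡m%n a n ⟨
      (a + n) % n           ≡⟨ cong (_% n) (unshift a) ⟨
      (i + a + (n ∸ i)) % n ≡⟨ %-+-congʳ (n ∸ i) eq ⟩
      (i + b + (n ∸ i)) % n ≡⟨ cong (_% n) (unshift b) ⟩
      (b + n) % n           ≡⟨ [m+n]%n≡m%n b n ⟩
      b % n                 ≡⟨ m<n⇒m%n≡m b<n ⟩
      b                     ∎

    +-%-surjective : ∀ {r} → r < n → ∃ λ j → j < n × (i + j) % n ≡ r
    +-%-surjective {r} r<n = j , m%n<n _ n , (begin
      (i + j) % n             ≡⟨ %-+-congˡ i (m%n%n≡m%n (r + (n ∸ i)) n) ⟩
      (i + (r + (n ∸ i))) % n ≡⟨ cong (_% n) (+-assoc i r (n ∸ i)) ⟨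
      (i + r + (n ∸ i)) % n   ≡⟨ cong (_% n) (unshift r) ⟩
      (r + n) % n             ≡⟨ [m+n]%n≡m%n r n ⟩
      r % n                   ≡⟨ m<n⇒m%n≡m r<n ⟩
      r                       ∎)
      where j = (r + (n ∸ i)) % n

-- Walking around a Hamiltonian cycle

module _ where
  open import Data.Nat using (_+_; _≤_; _<_)
  open import Data.Nat.DivMod using (_%_; _mod_; m%n<n; [m+n]%n≡m%n; m<n⇒m%n≡m; n%n≡0)
  open import Data.Nat.Properties using (_<?_; ≤-antisym; ≮⇒≥; <⇒≤; +-suc; +-identityʳ)

  EdgesListed : ∀ {n} → (ℕ → List ℕ) → Graph n → Set
  EdgesListed nb G = ∀ i j → Adjacent G i j → toℕ j ∈ nb (toℕ i)

  adjacency-listed : ∀ {n} nb (i j : Fin n) → adjacency nb i j ≡ true → toℕ j ∈ nb (toℕ i)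
  adjacency-listed nb i _ = ∈ᵇ⇒∈ (nb (toℕ i)) ∘ Equivalence.from T-≡

  NeighboursBelow : (n : ℕ) → (ℕ → List ℕ) → Set
  NeighboursBelow n nb = ∀ (i : Fin n) → All (_< n) (nb (toℕ i))

  record HamiltonianWalk (n : ℕ) (nb : ℕ → List ℕ) (s : ℕ) : Set where
    field
      vertex             : ℕ → ℕ
      atLeast3           : 3 ≤ n
      starts             : vertex 0 ≡ s
      periodic           : vertex n ≡ vertex 0
      injective          : ∀ {i j} → i < n → j < n → vertex i ≡ vertex j → i ≡ j
      forward            : ∀ j → vertex (suc j) ∈ nb (vertex j)
      backward           : ∀ j → vertex j ∈ nb (vertex (suc j))
      neighbours-on-walk : ∀ j {u} → u ∈ nb (vertex j) → ∃ λ i → i < n × vertex i ≡ u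

  module _ {k nb} {G : Graph (suc k)} (listed : EdgesListed nb G) (below : NeighboursBelow (suc k) nb)
           (H : HamCycle G) where
    open HamCycle H
    open ≡-Reasoning

    private
      n : ℕ
      n = suc k

    cyclic-step : ∀ m → Adjacent G (order (m mod n)) (order (suc m mod n))
    cyclic-step m with m % n <? k
    ... | yes m%n<k = consecutive _ _ (begin
      toℕ (suc m mod n)     ≡⟨ toℕ-fromℕ< _ ⟩
      suc m % n             ≡⟨ suc-% n m ⟩
      suc (m % n) % n       ≡⟨ m<n⇒m%n≡m (s≤s m%n<k) ⟩
      suc (m % n)           ≡⟨ cong suc (toℕ-fromℕ< _) ⟨
      suc (toℕ (m mod n))   ∎)
    ... | no m%n≮k =
      subst₂ (λ i j → Adjacent G (order i) (order j)) (≡.sym last) (≡.sym first) closing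
      where
        m%n≡k : m % n ≡ k
        m%n≡k = ≤-antisym (s≤s⁻¹ (m%n<n m n)) (≮⇒≥ m%n≮k)
        last : m mod n ≡ fromℕ k
        last = toℕ-injective (trans (toℕ-fromℕ< _) (trans m%n≡k (≡.sym (toℕ-fromℕ k))))
        first : suc m mod n ≡ zero
        first = toℕ-injective (trans (toℕ-fromℕ< _)
                  (trans (suc-% n m) (trans (cong (λ x → suc x % n) m%n≡k) (n%n≡0 n))))

    module Walk {s} (s<n : s < n) where
      i₀ : Fin n
      i₀ = proj₁ (surjective (fromℕ< s<n))

      position : ℕ → Fin n
      position j = (toℕ i₀ + j) mod n

      vertex : ℕ → ℕ
      vertex = toℕ ∘ order ∘ position

      toℕ-position : ∀ j → toℕ (position j) ≡ (toℕ i₀ + j) % n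
      toℕ-position j = toℕ-fromℕ< _

      position-0 : position 0 ≡ i₀
      position-0 = toℕ-injective (begin
        toℕ (position 0)    ≡⟨ toℕ-position 0 ⟩
        (toℕ i₀ + 0) % n    ≡⟨ cong (_% n) (+-identityʳ (toℕ i₀)) ⟩
        toℕ i₀ % n          ≡⟨ m<n⇒m%n≡m (toℕ<n i₀) ⟩
        toℕ i₀              ∎)

      position-suc : ∀ j → position (suc j) ≡ suc (toℕ i₀ + j) mod n
      position-suc j = cong (_mod n) (+-suc (toℕ i₀) j)

      starts : vertex 0 ≡ s
      starts = trans (cong toℕ (proj₂ (surjective (fromℕ< s<n)) position-0)) (toℕ-fromℕ< s<n)

      periodic : vertex n ≡ vertex 0
      periodic = cong (toℕ ∘ order) (toℕ-injective (begin
        toℕ (position n)    ≡⟨ toℕ-position n ⟩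
        (toℕ i₀ + n) % n    ≡⟨ %-+-congˡ n (toℕ i₀) ([m+n]%n≡m%n 0 n) ⟩
        (toℕ i₀ + 0) % n    ≡⟨ toℕ-position 0 ⟨
        toℕ (position 0)    ∎))

      vertex-injective : ∀ {i j} → i < n → j < n → vertex i ≡ vertex j → i ≡ j
      vertex-injective {i} {j} i<n j<n eq = +-%-injective n (<⇒≤ (toℕ<n i₀)) i<n j<n (begin
        (toℕ i₀ + i) % n    ≡⟨ toℕ-position i ⟨
        toℕ (position i)    ≡⟨ cong toℕ (injective (toℕ-injective eq)) ⟩
        toℕ (position j)    ≡⟨ toℕ-position j ⟩
        (toℕ i₀ + j) % n    ∎)

      forward : ∀ j → vertex (suc j) ∈ nb (vertex j)
      forward j rewrite position-suc j = listed _ _ (cyclic-step (toℕ i₀ + j))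

      backward : ∀ j → vertex j ∈ nb (vertex (suc j))
      backward j rewrite position-suc j = listed _ _ (adjacent-sym G (cyclic-step (toℕ i₀ + j)))

      neighbours-on-walk : ∀ j {u} → u ∈ nb (vertex j) → ∃ λ i → i < n × vertex i ≡ u
      neighbours-on-walk j {u} u∈ =
        let i , i<n , i₀+i≡x = +-%-surjective n (<⇒≤ (toℕ<n i₀)) (toℕ<n x)
        in  i , i<n , (begin
              toℕ (order (position i)) ≡⟨ cong (toℕ ∘ order) (toℕ-injective
                                              (trans (toℕ-position i) i₀+i≡x)) ⟩
              toℕ (order x)            ≡⟨ cong toℕ (proj₂ (surjective (fromℕ< u<n)) refl) ⟩
              toℕ (fromℕ< u<n)         ≡⟨ toℕ-fromℕ< u<n ⟩
              u                        ∎)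
        where
          u<n : u < n
          u<n = All.lookup (below (order (position j))) u∈
          x : Fin n
          x = proj₁ (surjective (fromℕ< u<n))

    walk : ∀ {s} → s < n → HamiltonianWalk n nb s
    walk s<n = record
      { vertex             = vertex
      ; atLeast3           = atLeast3
      ; starts             = starts
      ; periodic           = periodic
      ; injective          = vertex-injective
      ; forward            = forward
      ; backward           = backward
      ; neighbours-on-walk = neighbours-on-walk
      }
      where open Walk s<n

module Search (nb : ℕ → List ℕ) (s : ℕ) where
  open import Data.Bool.ListAction using (any; all)
  open import Data.List using (length; filterᵇ; applyDownFrom)
  open import Data.List.Membership.Propositional using (lose)
  open import Data.List.Membership.Propositional.Properties
    using (∈-applyDownFrom⁺; ∈-applyDownFrom⁻; ∈-filter⁺)
  open import Data.List.Relation.Unary.All.Properties using (all⁻)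
  open import Data.List.Relation.Unary.Any.Properties using (any⁺)
  open import Data.Nat using (_+_; _≤_; _<_; _≤ᵇ_)
  open import Data.Nat.Properties
    using (_≟_; _<?_; _≤?_; ≤⇒≤ᵇ; ≤-antisym; ≤-reflexive; ≤-trans; <-trans; ≤∧≢⇒<; ≮⇒≥; ≰⇒>;
           <⇒≱; <⇒≤; m<n⇒m<1+n; m<m+n; +-suc; +-identityʳ)

  ∈⇒1≤length : ∀ {A : Set} {x : A} {xs} → x ∈ xs → 1 ≤ length xs
  ∈⇒1≤length (here _)  = s≤s z≤n
  ∈⇒1≤length (there _) = s≤s z≤n

  distinct-∈⇒2≤length : ∀ {A : Set} {x y : A} {xs} →
                        x ∈ xs → y ∈ xs → x ≢ y → 2 ≤ length xs
  distinct-∈⇒2≤length (here refl) (here refl) x≢y = contradiction refl x≢y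
  distinct-∈⇒2≤length (here _)    (there y∈) _    = s≤s (∈⇒1≤length y∈)
  distinct-∈⇒2≤length (there x∈)  (here _)   _    = s≤s (∈⇒1≤length x∈)
  distinct-∈⇒2≤length (there x∈)  (there y∈) x≢y  = m<n⇒m<1+n (distinct-∈⇒2≤length x∈ y∈ x≢y)

  available : ℕ → List ℕ → ℕ → Bool
  available cur path x = not (x ∈ᵇ path) ∨ ((x ≡ᵇ cur) ∨ (x ≡ᵇ s))

  viable : ℕ → ℕ → List ℕ → Bool
  viable prev cur path =
    all (λ u → (u ∈ᵇ path) ∨ (2 ≤ᵇ length (filterᵇ (available cur path) (nb u)))) (nb prev)

  -- extends r prev cur path: can the path (newest first: cur, prev, …, s) be extended by
  -- r more vertices and closed at s? Only the answer false is conclusive (search-complete).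
  -- viable prunes: once prev is passed, each of its unvisited neighbours still needs two
  -- available neighbours (unvisited, cur or s) to be its neighbours on the cycle.
  extends : ℕ → ℕ → ℕ → List ℕ → Bool
  extends zero    prev cur path = s ∈ᵇ nb cur
  extends (suc r) prev cur path =
    viable prev cur path ∧ any (λ y → not (y ∈ᵇ path) ∧ extends r cur y (y ∷ path)) (nb cur)

  Available : ℕ → List ℕ → ℕ → Set
  Available cur path x = x ∉ path ⊎ x ≡ cur ⊎ x ≡ s

  Available⇒available : ∀ {cur path x} → Available cur path x → T (available cur path x)
  Available⇒available {cur} {path} {x} a = Equivalence.from T-∨ (case a)
    where
      case : Available cur path x → T (not (x ∈ᵇ path)) ⊎ T ((x ≡ᵇ cur) ∨ (x ≡ᵇ s))
      case (inj₁ x∉path)      = inj₁ (∉⇒∉ᵇ path x∉path)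
      case (inj₂ (inj₁ refl)) = inj₂ (Equivalence.from T-∨ (inj₁ (≡⇒≡ᵇ x x refl)))
      case (inj₂ (inj₂ refl)) = inj₂ (Equivalence.from T-∨ (inj₂ (≡⇒≡ᵇ x x refl)))

  module _ {k} (W : HamiltonianWalk (suc k) nb s) where
    open HamiltonianWalk W

    private
      n : ℕ
      n = suc k

    path : ℕ → List ℕ
    path m = applyDownFrom vertex (suc m)

    later⇒unvisited : ∀ {m j} → m < j → j < n → vertex j ∉ path m
    later⇒unvisited {m} m<j j<n vj∈path with ∈-applyDownFrom⁻ vertex vj∈path
    ... | i , i<1+m , vj≡vi with injective j<n (<-trans (≤-trans i<1+m m<j) j<n) vj≡vi
    ...   | refl = <⇒≱ m<j (s≤s⁻¹ i<1+m)

    predecessor-available : ∀ {m i} → m ≤ i → suc i < n → Available (vertex m) (path m) (vertex i)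
    predecessor-available {m} {i} m≤i 1+i<n with m ≟ i
    ... | yes refl = inj₂ (inj₁ refl)
    ... | no m≢i   = inj₁ (later⇒unvisited (≤∧≢⇒< m≤i m≢i) (<⇒≤ 1+i<n))

    successor-available : ∀ {m j} → m < j → j < n → Available (vertex m) (path m) (vertex (suc j))
    successor-available {m} {j} m<j j<n with suc j <? n
    ... | yes 1+j<n = inj₁ (later⇒unvisited (m<n⇒m<1+n m<j) 1+j<n)
    ... | no 1+j≮n  =
      inj₂ (inj₂ (trans (cong vertex (≤-antisym j<n (≮⇒≥ 1+j≮n))) (trans periodic starts)))

    neighbours-distinct : ∀ {i} → suc i < n → vertex i ≢ vertex (suc (suc i))
    neighbours-distinct {i} 1+i<n eq with suc (suc i) <? n
    ... | yes 2+i<n with injective (<-trans (n<1+n i) 1+i<n) 2+i<n eq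
    ...   | ()
    neighbours-distinct {i} 1+i<n eq | no 2+i≮n =
      <⇒≱ atLeast3 (≤-reflexive (trans (≡.sym 2+i≡n) (cong (λ i → suc (suc i)) i≡0)))
      where
        2+i≡n : suc (suc i) ≡ n
        2+i≡n = ≤-antisym 1+i<n (≮⇒≥ 2+i≮n)
        i≡0 : i ≡ 0
        i≡0 = injective (<-trans (n<1+n i) 1+i<n) z<s (trans eq (trans (cong vertex 2+i≡n) periodic))

    two-available : ∀ {m j} → m < j → j < n →
                    2 ≤ length (filterᵇ (available (vertex m) (path m)) (nb (vertex j)))
    two-available {m} {suc i} m<1+i 1+i<n = distinct-∈⇒2≤length
      (∈-filter⁺ (T? ∘ available (vertex m) (path m)) (backward i)
        (Available⇒available (predecessor-available (s≤s⁻¹ m<1+i) 1+i<n)))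
      (∈-filter⁺ (T? ∘ available (vertex m) (path m)) (forward (suc i))
        (Available⇒available (successor-available m<1+i 1+i<n)))
      (neighbours-distinct 1+i<n)

    viable-along : ∀ m p → T (viable (vertex p) (vertex m) (path m))
    viable-along m p = all⁻ _ (All.tabulate λ u∈ → visited-or-two-available (neighbours-on-walk p u∈))
      where
        visited-or-two-available : ∀ {u} → ∃ (λ i → i < n × vertex i ≡ u) →
          T ((u ∈ᵇ path m) ∨ (2 ≤ᵇ length (filterᵇ (available (vertex m) (path m)) (nb u))))
        visited-or-two-available (i , i<n , refl) with i ≤? m
        ... | yes i≤m = Equivalence.from T-∨ (inj₁ (∈⇒∈ᵇ (∈-applyDownFrom⁺ vertex (s≤s i≤m))))
        ... | no  i≰m = Equivalence.from T-∨ (inj₂ (≤⇒≤ᵇ (two-available (≰⇒> i≰m) i<n)))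

    extends-along : ∀ r m → m + r ≡ k → ∀ p → T (extends r (vertex p) (vertex m) (path m))
    extends-along zero m m+0≡k p = ∈⇒∈ᵇ (subst (_∈ nb (vertex m)) returns (forward m))
      where
        returns : vertex (suc m) ≡ s
        returns =
          trans (cong (vertex ∘ suc) (trans (≡.sym (+-identityʳ m)) m+0≡k)) (trans periodic starts)
    extends-along (suc r) m m+1+r≡k p = Equivalence.from T-∧ (viable-along m p , any⁺ _ (lose (forward m)
      (Equivalence.from T-∧ (∉⇒∉ᵇ (path m) (later⇒unvisited (n<1+n m) 1+m<n) ,
                             extends-along r (suc m) (trans (≡.sym (+-suc m r)) m+1+r≡k) m))))
      where
        1+m<n : suc m < n
        1+m<n = s≤s (subst (suc m ≤_) m+1+r≡k (m<m+n m z<s))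

    walk⇒extends : T (extends k s s (s ∷ []))
    walk⇒extends = subst (λ x → T (extends k x x (x ∷ []))) starts (extends-along k 0 refl 0)

  search-complete : ∀ k → extends k s s (s ∷ []) ≡ false → ¬ HamiltonianWalk (suc k) nb s
  search-complete k fails W = subst T fails (walk⇒extends W)

module Plane where
  open import Data.Rational
    using (ℚ; 1ℚ; _+_; _*_; _-_; -_; _<_; _≤_; 1/_; NonZero; ≢-nonZero; positive; nonNegative)
  open import Data.Rational.Properties
    using (_<?_; <-irrefl; <-cmp; <-≤-trans; <⇒≤; +-monoˡ-≤; +-monoʳ-≤; +-mono-≤-<; neg-antimono-≤;
           +-inverseʳ; *-identityʳ; +-identityʳ; *-inverseʳ; *-assoc; *-zeroˡ; positive⁻¹; nonNegative⁻¹;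
           nonNeg*nonNeg⇒nonNeg; pos*pos⇒pos)
  open import Data.Rational.Solver using (module +-*-Solver)
  open import Relation.Binary.Definitions using (tri<; tri≈; tri>)
  open +-*-Solver
  open ≡-Reasoning

  -- twice the signed area of the triangle p q r: positive iff r lies left of the line p → q
  cross : Point → Point → Point → ℚ
  cross (p₁ , p₂) (q₁ , q₂) (r₁ , r₂) = (q₁ - p₁) * (r₂ - p₂) - (q₂ - p₂) * (r₁ - p₁)

  0≤1-t : ∀ {t} → t ≤ 1ℚ → 0ℚ ≤ 1ℚ - t
  0≤1-t {t} t≤1 = subst (_≤ 1ℚ - t) (+-inverseʳ t) (+-monoˡ-≤ (- t) t≤1)

  1-t≤1 : ∀ {t} → 0ℚ ≤ t → 1ℚ - t ≤ 1ℚ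
  1-t≤1 0≤t = +-monoʳ-≤ 1ℚ (neg-antimono-≤ 0≤t)

  onSegment-sym : ∀ {x} p q → OnSegment x p q → OnSegment x q p
  onSegment-sym (p₁ , p₂) (q₁ , q₂) (t , 0≤t , t≤1 , refl , refl) =
    1ℚ - t , 0≤1-t t≤1 , 1-t≤1 0≤t , reverse p₁ q₁ , reverse p₂ q₂
    where
      reverse : ∀ a b → a + t * (b - a) ≡ b + (1ℚ - t) * (a - b)
      reverse a b = solve 3 (λ a b t → a :+ t :* (b :- a) := b :+ (con 1ℚ :- t) :* (a :- b)) refl a b t

  cross-onSegment : ∀ {x} p q → OnSegment x p q → cross p q x ≡ 0ℚ
  cross-onSegment (p₁ , p₂) (q₁ , q₂) (t , _ , _ , refl , refl) = solve 5
    (λ p₁ p₂ q₁ q₂ t →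
       (q₁ :- p₁) :* ((p₂ :+ t :* (q₂ :- p₂)) :- p₂) :- (q₂ :- p₂) :* ((p₁ :+ t :* (q₁ :- p₁)) :- p₁)
       := con 0ℚ)
    refl p₁ p₂ q₁ q₂ t

  cross-onSegment-convex : ∀ {x} p q u v → OnSegment x u v →
    ∃ λ t → 0ℚ ≤ t × t ≤ 1ℚ × cross p q x ≡ (1ℚ - t) * cross p q u + t * cross p q v
  cross-onSegment-convex (p₁ , p₂) (q₁ , q₂) (u₁ , u₂) (v₁ , v₂) (t , 0≤t , t≤1 , refl , refl) =
    t , 0≤t , t≤1 , solve 9
      (λ p₁ p₂ q₁ q₂ u₁ u₂ v₁ v₂ t →
         (q₁ :- p₁) :* ((u₂ :+ t :* (v₂ :- u₂)) :- p₂) :- (q₂ :- p₂) :* ((u₁ :+ t :* (v₁ :- u₁)) :- p₁)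
         := (con 1ℚ :- t) :* ((q₁ :- p₁) :* (u₂ :- p₂) :- (q₂ :- p₂) :* (u₁ :- p₁))
            :+ t :* ((q₁ :- p₁) :* (v₂ :- p₂) :- (q₂ :- p₂) :* (v₁ :- p₁)))
      refl p₁ p₂ q₁ q₂ u₁ u₂ v₁ v₂ t

  0≤* : ∀ {p q} → 0ℚ ≤ p → 0ℚ ≤ q → 0ℚ ≤ p * q
  0≤* {p} {q} 0≤p 0≤q =
    nonNegative⁻¹ (p * q) {{nonNeg*nonNeg⇒nonNeg p {{nonNegative 0≤p}} q {{nonNegative 0≤q}}}}

  0<* : ∀ {p q} → 0ℚ < p → 0ℚ < q → 0ℚ < p * q
  0<* {p} {q} 0<p 0<q = positive⁻¹ (p * q) {{pos*pos⇒pos p {{positive 0<p}} q {{positive 0<q}}}}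

  0<convex-combination : ∀ {a b t} → 0ℚ < a → 0ℚ < b → 0ℚ ≤ t → t ≤ 1ℚ → 0ℚ < (1ℚ - t) * a + t * b
  0<convex-combination {a} {b} {t} 0<a 0<b 0≤t t≤1 with <-cmp 0ℚ t
  ... | tri< 0<t _ _  = +-mono-≤-< (0≤* (0≤1-t t≤1) (<⇒≤ 0<a)) (0<* 0<t 0<b)
  ... | tri≈ _ refl _ =
    subst (0ℚ <_) (solve 2 (λ a b → a := (con 1ℚ :- con 0ℚ) :* a :+ con 0ℚ :* b) refl a b) 0<a
  ... | tri> _ _ t<0  = contradiction (<-≤-trans t<0 0≤t) (<-irrefl refl)

  p*q≡0⇒p≡0 : ∀ s {k} → k ≢ 0ℚ → s * k ≡ 0ℚ → s ≡ 0ℚ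
  p*q≡0⇒p≡0 s {k} k≢0 sk≡0 = begin
    s              ≡⟨ *-identityʳ s ⟨
    s * 1ℚ         ≡⟨ cong (s *_) (*-inverseʳ k) ⟨
    s * (k * 1/ k) ≡⟨ *-assoc s k (1/ k) ⟨
    s * k * 1/ k   ≡⟨ cong (_* 1/ k) sk≡0 ⟩
    0ℚ * 1/ k      ≡⟨ *-zeroˡ (1/ k) ⟩
    0ℚ             ∎
    where
      instance
        k≢0′ : NonZero k
        k≢0′ = ≢-nonZero k≢0

  meet-at-common-endpoint : ∀ {x} p q r → cross p q r ≢ 0ℚ → OnSegment x p q → OnSegment x p r → x ≡ p
  meet-at-common-endpoint (p₁ , p₂) (q₁ , q₂) (r₁ , r₂) pqr≢0 x∈pq (t , _ , _ , refl , refl) =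
    cong₂ _,_ (at-start p₁ r₁) (at-start p₂ r₂)
    where
      scaled : cross (p₁ , p₂) (q₁ , q₂) (p₁ + t * (r₁ - p₁) , p₂ + t * (r₂ - p₂))
             ≡ t * cross (p₁ , p₂) (q₁ , q₂) (r₁ , r₂)
      scaled = solve 7
        (λ p₁ p₂ q₁ q₂ r₁ r₂ t →
           (q₁ :- p₁) :* ((p₂ :+ t :* (r₂ :- p₂)) :- p₂) :- (q₂ :- p₂) :* ((p₁ :+ t :* (r₁ :- p₁)) :- p₁)
           := t :* ((q₁ :- p₁) :* (r₂ :- p₂) :- (q₂ :- p₂) :* (r₁ :- p₁)))
        refl p₁ p₂ q₁ q₂ r₁ r₂ t
      t≡0 : t ≡ 0ℚ
      t≡0 = p*q≡0⇒p≡0 t pqr≢0 (trans (≡.sym scaled) (cross-onSegment (p₁ , p₂) (q₁ , q₂) x∈pq))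
      at-start : ∀ a b → a + t * (b - a) ≡ a
      at-start a b = begin
        a + t * (b - a)   ≡⟨ cong (λ t → a + t * (b - a)) t≡0 ⟩
        a + 0ℚ * (b - a)  ≡⟨ cong (a +_) (*-zeroˡ (b - a)) ⟩
        a + 0ℚ            ≡⟨ +-identityʳ a ⟩
        a                 ∎

  LeftOf : Point → Point → Point → Set
  LeftOf p q r = 0ℚ < cross p q r

  leftOf-onSegment : ∀ {x} p q u v → LeftOf p q u → LeftOf p q v → OnSegment x u v → LeftOf p q x
  leftOf-onSegment p q u v pqu pqv xuv with cross-onSegment-convex p q u v xuv
  ... | t , 0≤t , t≤1 , eq = subst (0ℚ <_) (≡.sym eq) (0<convex-combination pqu pqv 0≤t t≤1)

  Separates : Point → Point → Point → Point → Set
  Separates p q u v = LeftOf p q u × LeftOf p q v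

  separates⇒disjoint : ∀ {x} p q u v → Separates p q u v → OnSegment x p q → OnSegment x u v → ⊥
  separates⇒disjoint p q u v (pqu , pqv) xpq xuv =
    <-irrefl (≡.sym (cross-onSegment p q xpq)) (leftOf-onSegment p q u v pqu pqv xuv)

  SegmentsSeparated : Point → Point → Point → Point → Set
  SegmentsSeparated p q u v =
    Separates p q u v ⊎ Separates q p u v ⊎ Separates u v p q ⊎ Separates v u p q

  segmentsSeparated? : ∀ p q u v → Dec (SegmentsSeparated p q u v)
  segmentsSeparated? p q u v =
    separates? p q u v ⊎-dec separates? q p u v ⊎-dec separates? u v p q ⊎-dec separates? v u p q
    where
      separates? : ∀ p q u v → Dec (Separates p q u v)
      separates? p q u v = 0ℚ <? cross p q u ×-dec 0ℚ <? cross p q v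

  separated⇒disjoint : ∀ {x} p q u v → SegmentsSeparated p q u v →
                       OnSegment x p q → OnSegment x u v → ⊥
  separated⇒disjoint p q u v (inj₁ sep) xpq xuv =
    separates⇒disjoint p q u v sep xpq xuv
  separated⇒disjoint p q u v (inj₂ (inj₁ sep)) xpq xuv =
    separates⇒disjoint q p u v sep (onSegment-sym p q xpq) xuv
  separated⇒disjoint p q u v (inj₂ (inj₂ (inj₁ sep))) xpq xuv =
    separates⇒disjoint u v p q sep xuv xpq
  separated⇒disjoint p q u v (inj₂ (inj₂ (inj₂ sep))) xpq xuv =
    separates⇒disjoint v u p q sep (onSegment-sym u v xuv) xpq

module Drawing {n} (G : Graph n) (nb : ℕ → List ℕ) (listed : EdgesListed nb G) (point : ℕ → Point)
  where
  open Plane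
  open import Data.Nat.Properties using (_≟_)
  open import Data.Product.Properties using (≡-dec)
  import Data.Rational.Properties as ℚ
  open import Relation.Nullary using (¬?)

  position : Fin n → Point
  position = point ∘ toℕ

  PositionsDistinct : Set
  PositionsDistinct = ∀ i j → position i ≡ position j → i ≡ j

  positionsDistinct? : Dec PositionsDistinct
  positionsDistinct? = all? λ i → all? λ j → ≡-dec ℚ._≟_ ℚ._≟_ (position i) (position j) →-dec i ≟ᶠ j

  ClearOfLine : ℕ → ℕ → ℕ → Set
  ClearOfLine a b v = v ≡ a ⊎ v ≡ b ⊎ cross (point a) (point b) (point v) ≢ 0ℚ

  VerticesClearOfEdges : Set
  VerticesClearOfEdges =
    ∀ (a : Fin n) → All (λ b → ∀ (v : Fin n) → ClearOfLine (toℕ a) b (toℕ v)) (nb (toℕ a))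

  verticesClearOfEdges? : Dec VerticesClearOfEdges
  verticesClearOfEdges? = all? λ a → All.all? (λ b → all? λ v → clear? (toℕ a) b (toℕ v)) (nb (toℕ a))
    where
      clear? : ∀ a b v → Dec (ClearOfLine a b v)
      clear? a b v = v ≟ a ⊎-dec v ≟ b ⊎-dec ¬? (cross (point a) (point b) (point v) ℚ.≟ 0ℚ)

  EndpointsDistinct : ℕ → ℕ → ℕ → ℕ → Set
  EndpointsDistinct a b c d = a ≢ c × a ≢ d × b ≢ c × b ≢ d

  DisjointEdgesSeparated : Set
  DisjointEdgesSeparated = ∀ (a : Fin n) → All (λ b → ∀ (c : Fin n) → All (λ d →
      EndpointsDistinct (toℕ a) b (toℕ c) d →
      SegmentsSeparated (point (toℕ a)) (point b) (point (toℕ c)) (point d))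
    (nb (toℕ c))) (nb (toℕ a))

  disjointEdgesSeparated? : Dec DisjointEdgesSeparated
  disjointEdgesSeparated? = all? λ a → All.all? (λ b → all? λ c → All.all? (λ d →
      distinct? (toℕ a) b (toℕ c) d →-dec
      segmentsSeparated? (point (toℕ a)) (point b) (point (toℕ c)) (point d))
    (nb (toℕ c))) (nb (toℕ a))
    where
      distinct? : ∀ a b c d → Dec (EndpointsDistinct a b c d)
      distinct? a b c d = ¬? (a ≟ c) ×-dec ¬? (a ≟ d) ×-dec ¬? (b ≟ c) ×-dec ¬? (b ≟ d)

  module _ (distinct : PositionsDistinct) (clear : VerticesClearOfEdges)
           (separated : DisjointEdgesSeparated) where

    noncollinear : ∀ {a b v} → Adjacent G a b → v ≢ a → v ≢ b →
                   cross (position a) (position b) (position v) ≢ 0ℚ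
    noncollinear {a} {b} {v} ab v≢a v≢b with All.lookup (clear a) (listed a b ab) v
    ... | inj₁ v≡a        = contradiction (toℕ-injective v≡a) v≢a
    ... | inj₂ (inj₁ v≡b) = contradiction (toℕ-injective v≡b) v≢b
    ... | inj₂ (inj₂ ≢0)  = ≢0

    meet-at-common-vertex : ∀ {a b d x} → Adjacent G a b → d ≢ a → d ≢ b →
      OnSegment x (position a) (position b) → OnSegment x (position a) (position d) → x ≡ position a
    meet-at-common-vertex {a} {b} {d} ab d≢a d≢b =
      meet-at-common-endpoint (position a) (position b) (position d) (noncollinear ab d≢a d≢b)

    disjoint-edges-apart : ∀ {a b c d x} → Adjacent G a b → Adjacent G c d →
      a ≢ c → a ≢ d → b ≢ c → b ≢ d →
      OnSegment x (position a) (position b) → OnSegment x (position c) (position d) → ⊥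
    disjoint-edges-apart {a} {b} {c} {d} ab cd a≢c a≢d b≢c b≢d =
      separated⇒disjoint (position a) (position b) (position c) (position d)
        (All.lookup (All.lookup (separated a) (listed a b ab) c) (listed c d cd)
          (≢ℕ a≢c , ≢ℕ a≢d , ≢ℕ b≢c , ≢ℕ b≢d))
      where
        ≢ℕ : ∀ {i j : Fin n} → i ≢ j → toℕ i ≢ toℕ j
        ≢ℕ i≢j = i≢j ∘ toℕ-injective

    edges-meet-at-endpoints : ∀ a b c d → Adjacent G a b → Adjacent G c d →
      ¬ ((a ≡ c × b ≡ d) ⊎ (a ≡ d × b ≡ c)) →
      ∀ x → OnSegment x (position a) (position b) → OnSegment x (position c) (position d) →
      ∃ λ v → x ≡ position v × (v ≡ a ⊎ v ≡ b) × (v ≡ c ⊎ v ≡ d)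
    edges-meet-at-endpoints a b c d ab cd other x xab xcd with a ≟ᶠ c
    ... | yes refl =
      a , meet-at-common-vertex ab (adjacent⇒≢ G cd ∘ ≡.sym) (λ d≡b → other (inj₁ (refl , ≡.sym d≡b)))
            xab xcd
        , inj₁ refl , inj₁ refl
    ... | no a≢c with a ≟ᶠ d
    ...   | yes refl =
      a , meet-at-common-vertex ab (adjacent⇒≢ G cd) (λ c≡b → other (inj₂ (refl , ≡.sym c≡b)))
            xab (onSegment-sym (position c) (position a) xcd)
        , inj₁ refl , inj₂ refl
    ...   | no a≢d with b ≟ᶠ c
    ...     | yes refl =
      b , meet-at-common-vertex (adjacent-sym G ab) (adjacent⇒≢ G cd ∘ ≡.sym) (a≢d ∘ ≡.sym)
            (onSegment-sym (position a) (position b) xab) xcd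
        , inj₂ refl , inj₁ refl
    ...     | no b≢c with b ≟ᶠ d
    ...       | yes refl =
      b , meet-at-common-vertex (adjacent-sym G ab) (adjacent⇒≢ G cd) (a≢c ∘ ≡.sym)
            (onSegment-sym (position a) (position b) xab) (onSegment-sym (position c) (position b) xcd)
        , inj₂ refl , inj₂ refl
    ...       | no b≢d = ⊥-elim (disjoint-edges-apart ab cd a≢c a≢d b≢c b≢d xab xcd)

    embedding : StraightLineEmbedding G
    embedding = record
      { pos                     = position
      ; pos-injective           = distinct _ _
      ; no-vertex-on-edge       = λ a b v ab v≢a v≢b →
                                    noncollinear ab v≢a v≢b ∘ cross-onSegment (position a) (position b)
      ; edges-meet-at-endpoints = edges-meet-at-endpoints
      }

adjacencyLists : List (List ℕ)
adjacencyLists =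
    (2 ∷ 3 ∷ 36 ∷ [])
  ∷ (2 ∷ 3 ∷ 37 ∷ [])
  ∷ (0 ∷ 1 ∷ 20 ∷ 22 ∷ [])
  ∷ (0 ∷ 1 ∷ 24 ∷ 26 ∷ [])
  ∷ (5 ∷ 8 ∷ 17 ∷ [])
  ∷ (4 ∷ 6 ∷ 18 ∷ [])
  ∷ (5 ∷ 7 ∷ 34 ∷ [])
  ∷ (6 ∷ 8 ∷ 21 ∷ [])
  ∷ (4 ∷ 7 ∷ 30 ∷ 31 ∷ [])
  ∷ (10 ∷ 13 ∷ 14 ∷ [])
  ∷ (9 ∷ 11 ∷ 15 ∷ [])
  ∷ (10 ∷ 12 ∷ 32 ∷ [])
  ∷ (11 ∷ 13 ∷ 25 ∷ [])
  ∷ (9 ∷ 12 ∷ 28 ∷ 29 ∷ [])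
  ∷ (9 ∷ 16 ∷ 31 ∷ [])
  ∷ (10 ∷ 16 ∷ 33 ∷ [])
  ∷ (14 ∷ 15 ∷ 30 ∷ [])
  ∷ (4 ∷ 19 ∷ 29 ∷ [])
  ∷ (5 ∷ 19 ∷ 35 ∷ [])
  ∷ (17 ∷ 18 ∷ 28 ∷ [])
  ∷ (2 ∷ 23 ∷ 37 ∷ 39 ∷ [])
  ∷ (7 ∷ 22 ∷ 23 ∷ [])
  ∷ (2 ∷ 21 ∷ 30 ∷ 36 ∷ [])
  ∷ (20 ∷ 21 ∷ 34 ∷ [])
  ∷ (3 ∷ 27 ∷ 36 ∷ 38 ∷ [])
  ∷ (12 ∷ 26 ∷ 27 ∷ [])
  ∷ (3 ∷ 25 ∷ 28 ∷ 37 ∷ [])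
  ∷ (24 ∷ 25 ∷ 32 ∷ [])
  ∷ (13 ∷ 19 ∷ 26 ∷ 39 ∷ [])
  ∷ (13 ∷ 17 ∷ 31 ∷ [])
  ∷ (8 ∷ 16 ∷ 22 ∷ 38 ∷ [])
  ∷ (8 ∷ 14 ∷ 29 ∷ [])
  ∷ (11 ∷ 27 ∷ 33 ∷ [])
  ∷ (15 ∷ 32 ∷ 38 ∷ [])
  ∷ (6 ∷ 23 ∷ 35 ∷ [])
  ∷ (18 ∷ 34 ∷ 39 ∷ [])
  ∷ (0 ∷ 22 ∷ 24 ∷ [])
  ∷ (1 ∷ 20 ∷ 26 ∷ [])
  ∷ (24 ∷ 30 ∷ 33 ∷ [])
  ∷ (20 ∷ 28 ∷ 35 ∷ [])
  ∷ []

neighbours : ℕ → List ℕ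
neighbours i = fromMaybe [] (head (drop i adjacencyLists))

module Witnesses where
  open import Agda.Builtin.FromNat using (Number; fromNat)
  open import Agda.Builtin.FromNeg using (Negative; fromNeg)
  open import Data.Unit using (tt)
  open import Data.Rational using (ℚ)
  import Data.Nat.Literals as ℕ
  import Data.Fin.Literals as Fin
  import Data.Rational.Literals as ℚ
  open Data.Vec using ([]; _∷_)

  instance
    ℕ-number : Number ℕ
    ℕ-number = ℕ.number
    Fin-number : ∀ {n} → Number (Fin n)
    Fin-number {n} = Fin.number n
    ℚ-number : Number ℚ
    ℚ-number = ℚ.number
    ℚ-negative : Negative ℚ
    ℚ-negative = ℚ.negative

  coordinates : List Point
  coordinates =
      (-319 , -295)
    ∷ (-408 , -369)
    ∷ (-376 , -227)
    ∷ (-352 , -437)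
    ∷ (-365 , 271)
    ∷ (-444 , 206)
    ∷ (-422 , 134)
    ∷ (-345 , 116)
    ∷ (-257 , 215)
    ∷ (54 , 571)
    ∷ (211 , 315)
    ∷ (482 , 189)
    ∷ (951 , 309)
    ∷ (0 , 1000)
    ∷ (-48 , 397)
    ∷ (96 , 185)
    ∷ (-35 , 217)
    ∷ (-393 , 391)
    ∷ (-546 , 214)
    ∷ (-630 , 305)
    ∷ (-497 , -149)
    ∷ (-355 , -1)
    ∷ (-279 , -95)
    ∷ (-443 , -23)
    ∷ (-91 , -275)
    ∷ (587 , -809)
    ∷ (-588 , -809)
    ∷ (260 , -380)
    ∷ (-951 , 309)
    ∷ (-185 , 598)
    ∷ (-154 , 69)
    ∷ (-163 , 403)
    ∷ (285 , -56)
    ∷ (112 , 22)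
    ∷ (-476 , 81)
    ∷ (-564 , 131)
    ∷ (-230 , -222)
    ∷ (-498 , -442)
    ∷ (-44 , -61)
    ∷ (-671 , 97)
    ∷ []

  swap : Vec (Fin 40) 40
  swap = 1 ∷ 0 ∷ 3 ∷ 2 ∷ 9 ∷ 10 ∷ 11 ∷ 12 ∷ 13 ∷ 4 ∷ 5 ∷ 6 ∷ 7 ∷ 8 ∷ 17 ∷ 18 ∷ 19 ∷ 14 ∷ 15 ∷ 16 ∷ 24 ∷ 25 ∷ 26 ∷ 27 ∷ 20 ∷ 21 ∷ 22 ∷ 23 ∷ 30 ∷ 31 ∷ 28 ∷ 29 ∷ 34 ∷ 35 ∷ 32 ∷ 33 ∷ 37 ∷ 36 ∷ 39 ∷ 38 ∷ []

  cycles : Vec (Vec (Fin 39) 39) 40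
  cycles =
    (35 ∷ 21 ∷ 1 ∷ 0 ∷ 2 ∷ 25 ∷ 36 ∷ 19 ∷ 22 ∷ 20 ∷ 6 ∷ 5 ∷ 33 ∷ 34 ∷ 38 ∷ 27 ∷ 18 ∷ 17 ∷ 4 ∷ 3 ∷ 16 ∷ 28 ∷ 12 ∷ 8 ∷ 9 ∷ 10 ∷ 11 ∷ 24 ∷ 26 ∷ 31 ∷ 32 ∷ 14 ∷ 15 ∷ 13 ∷ 30 ∷ 7 ∷ 29 ∷ 37 ∷ 23 ∷ [])
    ∷ (36 ∷ 19 ∷ 1 ∷ 0 ∷ 2 ∷ 23 ∷ 35 ∷ 21 ∷ 20 ∷ 22 ∷ 33 ∷ 5 ∷ 6 ∷ 7 ∷ 3 ∷ 4 ∷ 17 ∷ 34 ∷ 38 ∷ 27 ∷ 18 ∷ 16 ∷ 28 ∷ 30 ∷ 13 ∷ 8 ∷ 12 ∷ 11 ∷ 10 ∷ 9 ∷ 14 ∷ 15 ∷ 29 ∷ 37 ∷ 32 ∷ 31 ∷ 26 ∷ 24 ∷ 25 ∷ [])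
    ∷ (0 ∷ 35 ∷ 21 ∷ 20 ∷ 6 ∷ 5 ∷ 4 ∷ 3 ∷ 7 ∷ 29 ∷ 15 ∷ 13 ∷ 30 ∷ 28 ∷ 16 ∷ 18 ∷ 17 ∷ 34 ∷ 33 ∷ 22 ∷ 19 ∷ 38 ∷ 27 ∷ 12 ∷ 8 ∷ 9 ∷ 14 ∷ 32 ∷ 37 ∷ 23 ∷ 26 ∷ 31 ∷ 10 ∷ 11 ∷ 24 ∷ 25 ∷ 36 ∷ 1 ∷ 2 ∷ [])
    ∷ (0 ∷ 35 ∷ 23 ∷ 26 ∷ 24 ∷ 11 ∷ 10 ∷ 31 ∷ 32 ∷ 37 ∷ 29 ∷ 21 ∷ 20 ∷ 6 ∷ 5 ∷ 4 ∷ 3 ∷ 7 ∷ 30 ∷ 13 ∷ 15 ∷ 14 ∷ 9 ∷ 8 ∷ 12 ∷ 28 ∷ 16 ∷ 18 ∷ 17 ∷ 34 ∷ 33 ∷ 22 ∷ 19 ∷ 38 ∷ 27 ∷ 25 ∷ 36 ∷ 1 ∷ 2 ∷ [])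
    ∷ (4 ∷ 5 ∷ 6 ∷ 7 ∷ 30 ∷ 13 ∷ 8 ∷ 9 ∷ 10 ∷ 11 ∷ 12 ∷ 28 ∷ 16 ∷ 18 ∷ 27 ∷ 38 ∷ 19 ∷ 36 ∷ 1 ∷ 2 ∷ 0 ∷ 3 ∷ 25 ∷ 24 ∷ 26 ∷ 31 ∷ 32 ∷ 14 ∷ 15 ∷ 29 ∷ 37 ∷ 23 ∷ 35 ∷ 21 ∷ 20 ∷ 22 ∷ 33 ∷ 34 ∷ 17 ∷ [])
    ∷ (4 ∷ 16 ∷ 18 ∷ 17 ∷ 34 ∷ 33 ∷ 5 ∷ 6 ∷ 20 ∷ 22 ∷ 19 ∷ 38 ∷ 27 ∷ 25 ∷ 36 ∷ 1 ∷ 2 ∷ 0 ∷ 3 ∷ 23 ∷ 35 ∷ 21 ∷ 29 ∷ 37 ∷ 32 ∷ 14 ∷ 15 ∷ 13 ∷ 8 ∷ 9 ∷ 10 ∷ 31 ∷ 26 ∷ 24 ∷ 11 ∷ 12 ∷ 28 ∷ 30 ∷ 7 ∷ [])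
    ∷ (5 ∷ 4 ∷ 16 ∷ 18 ∷ 27 ∷ 38 ∷ 19 ∷ 36 ∷ 1 ∷ 2 ∷ 0 ∷ 35 ∷ 21 ∷ 29 ∷ 15 ∷ 13 ∷ 8 ∷ 9 ∷ 14 ∷ 32 ∷ 37 ∷ 23 ∷ 3 ∷ 25 ∷ 24 ∷ 26 ∷ 31 ∷ 10 ∷ 11 ∷ 12 ∷ 28 ∷ 30 ∷ 7 ∷ 6 ∷ 20 ∷ 22 ∷ 33 ∷ 34 ∷ 17 ∷ [])
    ∷ (6 ∷ 5 ∷ 4 ∷ 7 ∷ 30 ∷ 13 ∷ 8 ∷ 9 ∷ 10 ∷ 11 ∷ 12 ∷ 28 ∷ 16 ∷ 18 ∷ 17 ∷ 34 ∷ 38 ∷ 27 ∷ 25 ∷ 24 ∷ 26 ∷ 31 ∷ 32 ∷ 14 ∷ 15 ∷ 29 ∷ 37 ∷ 23 ∷ 3 ∷ 1 ∷ 36 ∷ 19 ∷ 2 ∷ 0 ∷ 35 ∷ 21 ∷ 20 ∷ 22 ∷ 33 ∷ [])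
    ∷ (4 ∷ 5 ∷ 6 ∷ 7 ∷ 20 ∷ 22 ∷ 33 ∷ 34 ∷ 17 ∷ 18 ∷ 27 ∷ 38 ∷ 19 ∷ 36 ∷ 1 ∷ 2 ∷ 0 ∷ 3 ∷ 25 ∷ 24 ∷ 11 ∷ 12 ∷ 8 ∷ 9 ∷ 10 ∷ 31 ∷ 26 ∷ 23 ∷ 35 ∷ 21 ∷ 29 ∷ 37 ∷ 32 ∷ 14 ∷ 15 ∷ 13 ∷ 30 ∷ 28 ∷ 16 ∷ [])
    ∷ (9 ∷ 10 ∷ 11 ∷ 12 ∷ 28 ∷ 16 ∷ 4 ∷ 5 ∷ 6 ∷ 7 ∷ 8 ∷ 30 ∷ 13 ∷ 15 ∷ 29 ∷ 37 ∷ 23 ∷ 35 ∷ 0 ∷ 3 ∷ 1 ∷ 2 ∷ 21 ∷ 20 ∷ 22 ∷ 33 ∷ 34 ∷ 17 ∷ 18 ∷ 27 ∷ 38 ∷ 19 ∷ 36 ∷ 25 ∷ 24 ∷ 26 ∷ 31 ∷ 32 ∷ 14 ∷ [])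
    ∷ (9 ∷ 13 ∷ 15 ∷ 14 ∷ 32 ∷ 31 ∷ 10 ∷ 11 ∷ 24 ∷ 26 ∷ 23 ∷ 37 ∷ 29 ∷ 21 ∷ 35 ∷ 0 ∷ 2 ∷ 19 ∷ 36 ∷ 1 ∷ 3 ∷ 25 ∷ 27 ∷ 38 ∷ 34 ∷ 17 ∷ 18 ∷ 16 ∷ 4 ∷ 5 ∷ 6 ∷ 33 ∷ 22 ∷ 20 ∷ 7 ∷ 8 ∷ 30 ∷ 28 ∷ 12 ∷ [])
    ∷ (10 ∷ 9 ∷ 13 ∷ 15 ∷ 29 ∷ 37 ∷ 23 ∷ 35 ∷ 0 ∷ 3 ∷ 1 ∷ 36 ∷ 25 ∷ 27 ∷ 18 ∷ 16 ∷ 4 ∷ 5 ∷ 17 ∷ 34 ∷ 38 ∷ 19 ∷ 2 ∷ 21 ∷ 20 ∷ 22 ∷ 33 ∷ 6 ∷ 7 ∷ 8 ∷ 30 ∷ 28 ∷ 12 ∷ 11 ∷ 24 ∷ 26 ∷ 31 ∷ 32 ∷ 14 ∷ [])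
    ∷ (11 ∷ 10 ∷ 9 ∷ 12 ∷ 28 ∷ 16 ∷ 4 ∷ 5 ∷ 6 ∷ 7 ∷ 8 ∷ 30 ∷ 13 ∷ 15 ∷ 14 ∷ 32 ∷ 37 ∷ 29 ∷ 21 ∷ 20 ∷ 22 ∷ 33 ∷ 34 ∷ 17 ∷ 18 ∷ 27 ∷ 38 ∷ 19 ∷ 2 ∷ 0 ∷ 35 ∷ 23 ∷ 3 ∷ 1 ∷ 36 ∷ 25 ∷ 24 ∷ 26 ∷ 31 ∷ [])
    ∷ (9 ∷ 10 ∷ 11 ∷ 12 ∷ 24 ∷ 26 ∷ 31 ∷ 32 ∷ 14 ∷ 15 ∷ 29 ∷ 37 ∷ 23 ∷ 35 ∷ 0 ∷ 3 ∷ 1 ∷ 2 ∷ 21 ∷ 20 ∷ 7 ∷ 8 ∷ 4 ∷ 5 ∷ 6 ∷ 33 ∷ 22 ∷ 19 ∷ 36 ∷ 25 ∷ 27 ∷ 38 ∷ 34 ∷ 17 ∷ 18 ∷ 16 ∷ 28 ∷ 30 ∷ 13 ∷ [])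
    ∷ (9 ∷ 10 ∷ 11 ∷ 12 ∷ 24 ∷ 26 ∷ 31 ∷ 32 ∷ 14 ∷ 15 ∷ 29 ∷ 37 ∷ 23 ∷ 35 ∷ 0 ∷ 3 ∷ 1 ∷ 36 ∷ 25 ∷ 27 ∷ 18 ∷ 16 ∷ 4 ∷ 5 ∷ 17 ∷ 34 ∷ 38 ∷ 19 ∷ 2 ∷ 21 ∷ 20 ∷ 22 ∷ 33 ∷ 6 ∷ 7 ∷ 8 ∷ 30 ∷ 28 ∷ 13 ∷ [])
    ∷ (10 ∷ 9 ∷ 14 ∷ 15 ∷ 29 ∷ 37 ∷ 32 ∷ 31 ∷ 26 ∷ 23 ∷ 35 ∷ 0 ∷ 3 ∷ 1 ∷ 2 ∷ 21 ∷ 20 ∷ 7 ∷ 6 ∷ 5 ∷ 17 ∷ 18 ∷ 16 ∷ 4 ∷ 8 ∷ 30 ∷ 28 ∷ 13 ∷ 27 ∷ 38 ∷ 34 ∷ 33 ∷ 22 ∷ 19 ∷ 36 ∷ 25 ∷ 24 ∷ 12 ∷ 11 ∷ [])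
    ∷ (14 ∷ 9 ∷ 10 ∷ 15 ∷ 32 ∷ 31 ∷ 11 ∷ 12 ∷ 13 ∷ 28 ∷ 16 ∷ 4 ∷ 5 ∷ 6 ∷ 7 ∷ 20 ∷ 22 ∷ 33 ∷ 34 ∷ 17 ∷ 18 ∷ 27 ∷ 38 ∷ 19 ∷ 36 ∷ 1 ∷ 2 ∷ 21 ∷ 35 ∷ 0 ∷ 3 ∷ 25 ∷ 24 ∷ 26 ∷ 23 ∷ 37 ∷ 29 ∷ 8 ∷ 30 ∷ [])
    ∷ (4 ∷ 5 ∷ 6 ∷ 7 ∷ 20 ∷ 22 ∷ 33 ∷ 34 ∷ 17 ∷ 18 ∷ 27 ∷ 38 ∷ 19 ∷ 36 ∷ 1 ∷ 2 ∷ 0 ∷ 35 ∷ 21 ∷ 29 ∷ 16 ∷ 14 ∷ 9 ∷ 10 ∷ 15 ∷ 32 ∷ 37 ∷ 23 ∷ 3 ∷ 25 ∷ 24 ∷ 26 ∷ 31 ∷ 11 ∷ 12 ∷ 13 ∷ 28 ∷ 30 ∷ 8 ∷ [])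
    ∷ (5 ∷ 4 ∷ 17 ∷ 18 ∷ 27 ∷ 38 ∷ 34 ∷ 33 ∷ 22 ∷ 19 ∷ 36 ∷ 1 ∷ 2 ∷ 0 ∷ 3 ∷ 25 ∷ 24 ∷ 12 ∷ 11 ∷ 10 ∷ 15 ∷ 16 ∷ 14 ∷ 9 ∷ 13 ∷ 28 ∷ 30 ∷ 8 ∷ 29 ∷ 37 ∷ 32 ∷ 31 ∷ 26 ∷ 23 ∷ 35 ∷ 21 ∷ 20 ∷ 7 ∷ 6 ∷ [])
    ∷ (17 ∷ 4 ∷ 5 ∷ 18 ∷ 34 ∷ 33 ∷ 6 ∷ 7 ∷ 8 ∷ 30 ∷ 14 ∷ 9 ∷ 10 ∷ 11 ∷ 12 ∷ 24 ∷ 26 ∷ 31 ∷ 32 ∷ 15 ∷ 16 ∷ 29 ∷ 37 ∷ 23 ∷ 35 ∷ 0 ∷ 3 ∷ 25 ∷ 36 ∷ 1 ∷ 2 ∷ 21 ∷ 20 ∷ 22 ∷ 19 ∷ 38 ∷ 27 ∷ 13 ∷ 28 ∷ [])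
    ∷ (22 ∷ 20 ∷ 7 ∷ 6 ∷ 5 ∷ 18 ∷ 19 ∷ 17 ∷ 4 ∷ 8 ∷ 30 ∷ 28 ∷ 13 ∷ 9 ∷ 14 ∷ 16 ∷ 15 ∷ 10 ∷ 11 ∷ 12 ∷ 24 ∷ 26 ∷ 31 ∷ 32 ∷ 37 ∷ 29 ∷ 21 ∷ 2 ∷ 0 ∷ 35 ∷ 23 ∷ 3 ∷ 1 ∷ 36 ∷ 25 ∷ 27 ∷ 38 ∷ 34 ∷ 33 ∷ [])
    ∷ (7 ∷ 6 ∷ 5 ∷ 4 ∷ 17 ∷ 19 ∷ 18 ∷ 34 ∷ 33 ∷ 22 ∷ 20 ∷ 38 ∷ 27 ∷ 25 ∷ 36 ∷ 1 ∷ 2 ∷ 0 ∷ 3 ∷ 23 ∷ 35 ∷ 21 ∷ 29 ∷ 37 ∷ 32 ∷ 15 ∷ 16 ∷ 14 ∷ 9 ∷ 10 ∷ 11 ∷ 31 ∷ 26 ∷ 24 ∷ 12 ∷ 13 ∷ 28 ∷ 30 ∷ 8 ∷ [])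
    ∷ (21 ∷ 7 ∷ 6 ∷ 5 ∷ 4 ∷ 8 ∷ 29 ∷ 16 ∷ 15 ∷ 10 ∷ 11 ∷ 12 ∷ 24 ∷ 26 ∷ 31 ∷ 32 ∷ 37 ∷ 23 ∷ 35 ∷ 0 ∷ 2 ∷ 1 ∷ 3 ∷ 25 ∷ 36 ∷ 20 ∷ 38 ∷ 27 ∷ 13 ∷ 9 ∷ 14 ∷ 30 ∷ 28 ∷ 17 ∷ 19 ∷ 18 ∷ 34 ∷ 33 ∷ 22 ∷ [])
    ∷ (21 ∷ 7 ∷ 6 ∷ 33 ∷ 34 ∷ 18 ∷ 5 ∷ 4 ∷ 8 ∷ 30 ∷ 14 ∷ 9 ∷ 10 ∷ 11 ∷ 12 ∷ 13 ∷ 28 ∷ 17 ∷ 19 ∷ 27 ∷ 38 ∷ 20 ∷ 36 ∷ 1 ∷ 2 ∷ 0 ∷ 3 ∷ 25 ∷ 24 ∷ 26 ∷ 31 ∷ 32 ∷ 15 ∷ 16 ∷ 29 ∷ 37 ∷ 23 ∷ 35 ∷ 22 ∷ [])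
    ∷ (26 ∷ 24 ∷ 12 ∷ 11 ∷ 10 ∷ 15 ∷ 16 ∷ 14 ∷ 9 ∷ 13 ∷ 28 ∷ 30 ∷ 8 ∷ 4 ∷ 17 ∷ 19 ∷ 18 ∷ 5 ∷ 6 ∷ 7 ∷ 21 ∷ 23 ∷ 33 ∷ 34 ∷ 38 ∷ 27 ∷ 25 ∷ 3 ∷ 1 ∷ 36 ∷ 20 ∷ 2 ∷ 0 ∷ 35 ∷ 22 ∷ 29 ∷ 37 ∷ 32 ∷ 31 ∷ [])
    ∷ (12 ∷ 11 ∷ 10 ∷ 9 ∷ 14 ∷ 16 ∷ 15 ∷ 32 ∷ 31 ∷ 26 ∷ 24 ∷ 37 ∷ 29 ∷ 22 ∷ 35 ∷ 0 ∷ 2 ∷ 20 ∷ 36 ∷ 1 ∷ 3 ∷ 25 ∷ 27 ∷ 38 ∷ 34 ∷ 18 ∷ 19 ∷ 17 ∷ 4 ∷ 5 ∷ 6 ∷ 33 ∷ 23 ∷ 21 ∷ 7 ∷ 8 ∷ 30 ∷ 28 ∷ 13 ∷ [])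
    ∷ (25 ∷ 12 ∷ 11 ∷ 10 ∷ 9 ∷ 13 ∷ 27 ∷ 19 ∷ 18 ∷ 5 ∷ 6 ∷ 7 ∷ 21 ∷ 23 ∷ 33 ∷ 34 ∷ 38 ∷ 20 ∷ 36 ∷ 1 ∷ 2 ∷ 22 ∷ 35 ∷ 0 ∷ 3 ∷ 24 ∷ 37 ∷ 29 ∷ 8 ∷ 4 ∷ 17 ∷ 28 ∷ 30 ∷ 14 ∷ 16 ∷ 15 ∷ 32 ∷ 31 ∷ 26 ∷ [])
    ∷ (25 ∷ 12 ∷ 11 ∷ 31 ∷ 32 ∷ 15 ∷ 10 ∷ 9 ∷ 13 ∷ 28 ∷ 17 ∷ 4 ∷ 5 ∷ 6 ∷ 7 ∷ 8 ∷ 30 ∷ 14 ∷ 16 ∷ 29 ∷ 37 ∷ 24 ∷ 35 ∷ 0 ∷ 3 ∷ 1 ∷ 2 ∷ 22 ∷ 21 ∷ 23 ∷ 33 ∷ 34 ∷ 18 ∷ 19 ∷ 27 ∷ 38 ∷ 20 ∷ 36 ∷ 26 ∷ [])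
    ∷ (19 ∷ 17 ∷ 4 ∷ 5 ∷ 6 ∷ 33 ∷ 23 ∷ 21 ∷ 7 ∷ 8 ∷ 30 ∷ 28 ∷ 13 ∷ 9 ∷ 14 ∷ 16 ∷ 15 ∷ 10 ∷ 11 ∷ 12 ∷ 25 ∷ 26 ∷ 36 ∷ 1 ∷ 3 ∷ 0 ∷ 35 ∷ 24 ∷ 27 ∷ 31 ∷ 32 ∷ 37 ∷ 29 ∷ 22 ∷ 2 ∷ 20 ∷ 38 ∷ 34 ∷ 18 ∷ [])
    ∷ (17 ∷ 4 ∷ 5 ∷ 6 ∷ 7 ∷ 8 ∷ 30 ∷ 14 ∷ 9 ∷ 10 ∷ 11 ∷ 12 ∷ 13 ∷ 28 ∷ 38 ∷ 20 ∷ 36 ∷ 1 ∷ 2 ∷ 0 ∷ 3 ∷ 26 ∷ 25 ∷ 27 ∷ 31 ∷ 32 ∷ 15 ∷ 16 ∷ 29 ∷ 37 ∷ 24 ∷ 35 ∷ 22 ∷ 21 ∷ 23 ∷ 33 ∷ 34 ∷ 18 ∷ 19 ∷ [])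
    ∷ (16 ∷ 14 ∷ 9 ∷ 10 ∷ 11 ∷ 31 ∷ 27 ∷ 25 ∷ 12 ∷ 13 ∷ 29 ∷ 30 ∷ 8 ∷ 4 ∷ 17 ∷ 19 ∷ 18 ∷ 5 ∷ 6 ∷ 7 ∷ 21 ∷ 22 ∷ 35 ∷ 0 ∷ 2 ∷ 1 ∷ 36 ∷ 20 ∷ 23 ∷ 33 ∷ 34 ∷ 38 ∷ 28 ∷ 26 ∷ 3 ∷ 24 ∷ 37 ∷ 32 ∷ 15 ∷ [])
    ∷ (14 ∷ 9 ∷ 10 ∷ 11 ∷ 12 ∷ 13 ∷ 29 ∷ 17 ∷ 4 ∷ 5 ∷ 6 ∷ 7 ∷ 8 ∷ 30 ∷ 37 ∷ 24 ∷ 35 ∷ 0 ∷ 3 ∷ 1 ∷ 2 ∷ 22 ∷ 21 ∷ 23 ∷ 33 ∷ 34 ∷ 18 ∷ 19 ∷ 28 ∷ 38 ∷ 20 ∷ 36 ∷ 26 ∷ 25 ∷ 27 ∷ 31 ∷ 32 ∷ 15 ∷ 16 ∷ [])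
    ∷ (11 ∷ 10 ∷ 9 ∷ 14 ∷ 16 ∷ 15 ∷ 32 ∷ 37 ∷ 30 ∷ 8 ∷ 31 ∷ 29 ∷ 13 ∷ 28 ∷ 19 ∷ 17 ∷ 4 ∷ 5 ∷ 18 ∷ 34 ∷ 38 ∷ 20 ∷ 23 ∷ 33 ∷ 6 ∷ 7 ∷ 21 ∷ 22 ∷ 2 ∷ 1 ∷ 36 ∷ 26 ∷ 3 ∷ 0 ∷ 35 ∷ 24 ∷ 27 ∷ 25 ∷ 12 ∷ [])
    ∷ (15 ∷ 10 ∷ 9 ∷ 14 ∷ 31 ∷ 29 ∷ 13 ∷ 12 ∷ 11 ∷ 32 ∷ 27 ∷ 25 ∷ 26 ∷ 28 ∷ 19 ∷ 17 ∷ 4 ∷ 8 ∷ 7 ∷ 21 ∷ 23 ∷ 33 ∷ 6 ∷ 5 ∷ 18 ∷ 34 ∷ 38 ∷ 20 ∷ 36 ∷ 1 ∷ 2 ∷ 22 ∷ 35 ∷ 0 ∷ 3 ∷ 24 ∷ 37 ∷ 30 ∷ 16 ∷ [])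
    ∷ (6 ∷ 5 ∷ 4 ∷ 17 ∷ 19 ∷ 18 ∷ 34 ∷ 38 ∷ 28 ∷ 13 ∷ 29 ∷ 31 ∷ 8 ∷ 30 ∷ 16 ∷ 14 ∷ 9 ∷ 10 ∷ 15 ∷ 33 ∷ 37 ∷ 24 ∷ 27 ∷ 32 ∷ 11 ∷ 12 ∷ 25 ∷ 26 ∷ 3 ∷ 0 ∷ 35 ∷ 22 ∷ 2 ∷ 1 ∷ 36 ∷ 20 ∷ 23 ∷ 21 ∷ 7 ∷ [])
    ∷ (18 ∷ 5 ∷ 4 ∷ 17 ∷ 29 ∷ 31 ∷ 8 ∷ 7 ∷ 6 ∷ 34 ∷ 23 ∷ 21 ∷ 22 ∷ 30 ∷ 16 ∷ 14 ∷ 9 ∷ 13 ∷ 12 ∷ 25 ∷ 27 ∷ 32 ∷ 11 ∷ 10 ∷ 15 ∷ 33 ∷ 37 ∷ 24 ∷ 35 ∷ 0 ∷ 2 ∷ 1 ∷ 3 ∷ 26 ∷ 36 ∷ 20 ∷ 38 ∷ 28 ∷ 19 ∷ [])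
    ∷ (0 ∷ 2 ∷ 1 ∷ 36 ∷ 20 ∷ 23 ∷ 21 ∷ 22 ∷ 30 ∷ 16 ∷ 14 ∷ 31 ∷ 8 ∷ 7 ∷ 6 ∷ 34 ∷ 35 ∷ 38 ∷ 28 ∷ 19 ∷ 18 ∷ 5 ∷ 4 ∷ 17 ∷ 29 ∷ 13 ∷ 9 ∷ 10 ∷ 15 ∷ 33 ∷ 37 ∷ 24 ∷ 27 ∷ 32 ∷ 11 ∷ 12 ∷ 25 ∷ 26 ∷ 3 ∷ [])
    ∷ (1 ∷ 2 ∷ 0 ∷ 36 ∷ 22 ∷ 21 ∷ 7 ∷ 6 ∷ 5 ∷ 4 ∷ 8 ∷ 30 ∷ 16 ∷ 14 ∷ 31 ∷ 29 ∷ 17 ∷ 19 ∷ 18 ∷ 35 ∷ 34 ∷ 23 ∷ 20 ∷ 38 ∷ 28 ∷ 13 ∷ 9 ∷ 10 ∷ 15 ∷ 33 ∷ 37 ∷ 24 ∷ 27 ∷ 32 ∷ 11 ∷ 12 ∷ 25 ∷ 26 ∷ 3 ∷ [])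
    ∷ (33 ∷ 15 ∷ 10 ∷ 9 ∷ 14 ∷ 16 ∷ 30 ∷ 8 ∷ 31 ∷ 29 ∷ 13 ∷ 28 ∷ 19 ∷ 17 ∷ 4 ∷ 5 ∷ 18 ∷ 35 ∷ 38 ∷ 20 ∷ 23 ∷ 34 ∷ 6 ∷ 7 ∷ 21 ∷ 22 ∷ 2 ∷ 1 ∷ 37 ∷ 26 ∷ 3 ∷ 0 ∷ 36 ∷ 24 ∷ 27 ∷ 25 ∷ 12 ∷ 11 ∷ 32 ∷ [])
    ∷ (35 ∷ 18 ∷ 5 ∷ 4 ∷ 17 ∷ 19 ∷ 28 ∷ 13 ∷ 29 ∷ 31 ∷ 8 ∷ 30 ∷ 16 ∷ 14 ∷ 9 ∷ 10 ∷ 15 ∷ 33 ∷ 38 ∷ 24 ∷ 27 ∷ 32 ∷ 11 ∷ 12 ∷ 25 ∷ 26 ∷ 3 ∷ 0 ∷ 36 ∷ 22 ∷ 2 ∷ 1 ∷ 37 ∷ 20 ∷ 23 ∷ 21 ∷ 7 ∷ 6 ∷ 34 ∷ [])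
    ∷ []

open Witnesses using (coordinates; swap; cycles)

point : ℕ → Point
point i = fromMaybe (0ℚ , 0ℚ) (head (drop i coordinates))

-- The proofs returned by the decision procedures are huge terms: abstract keeps the type
-- checker from unfolding them.
abstract
  symmetric : ∀ (i j : Fin 40) → adjacency neighbours i j ≡ adjacency neighbours j i
  symmetric = from-yes (all? λ (i : Fin 40) → all? λ (j : Fin 40) →
    adjacency neighbours i j Bool.≟ adjacency neighbours j i)

  irreflexive : ∀ (i : Fin 40) → adjacency neighbours i i ≡ false
  irreflexive = from-yes (all? λ (i : Fin 40) → adjacency neighbours i i Bool.≟ false)

G : Graph 40
G = record { adj = adjacency neighbours ; sym = symmetric ; loopless = irreflexive }

listed : EdgesListed neighbours G
listed = adjacency-listed neighbours

module DrawingG = Drawing G neighbours listed point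

abstract
  neighbours-below : NeighboursBelow 40 neighbours
  neighbours-below = from-yes (all? λ (i : Fin 40) → All.all? (ℕ._<? 40) (neighbours (toℕ i)))

  -- 22 is the start vertex with the smallest search tree.
  search-fails : Search.extends neighbours 22 39 22 22 (22 ∷ []) ≡ false
  search-fails = refl

  cycles-hamiltonian : ∀ v → IsHamiltonianOrder (G -v v) (lookup (lookup cycles v))
  cycles-hamiltonian =
    from-yes (all? λ (v : Fin 40) → isHamiltonianOrder? (G -v v) (lookup (lookup cycles v)))

  swap-automorphism : IsAutomorphism G (lookup swap)
  swap-automorphism = from-yes (isAutomorphism? G (lookup swap))

  positions-distinct : DrawingG.PositionsDistinct
  positions-distinct = from-yes DrawingG.positionsDistinct?

  vertices-clear : DrawingG.VerticesClearOfEdges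
  vertices-clear = from-yes DrawingG.verticesClearOfEdges?

  edges-separated : DrawingG.DisjointEdgesSeparated
  edges-separated = from-yes DrawingG.disjointEdgesSeparated?

non-hamiltonian : ¬ Hamiltonian G
non-hamiltonian H = Search.search-complete neighbours 22 39 search-fails
  (walk listed neighbours-below H (from-yes (22 ℕ.<? 40)))

mainTheorem7 : Σ (Graph 40) λ G → Planar G × Hypohamiltonian G × NontrivialAutomorphism G
mainTheorem7 = G , DrawingG.embedding positions-distinct vertices-clear edges-separated
             , (non-hamiltonian , λ v → hamCycle (G -v v) (s≤s (s≤s (s≤s z≤n))) (cycles-hamiltonian v))
             , (automorphism swap-automorphism , zero , λ ())
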